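{- Let $P_E$ be the set of all primitive Eisenstein triples, i.e. triples $(a,b,c)\in\mathbb{Z}^3_{\geq 0}\setminus\{(0,0,0)\}$ with $a^2-ab+b^2=c^2$, $a\leq b$ and $\gcd(a,b,c)=1$. Let $G_E$ be the monoid generated (under matrix multiplication) by \[ U = \begin{bmatrix} -1&1&0 \\ 0&1&0 \\ 0&0&1 \end{bmatrix},\quad M_1 = \begin{bmatrix} 3 & -4 & 4 \\ 7 & -7 & 8 \\ 6 & -6 & 7 \end{bmatrix},\quad M_2 = \begin{bmatrix} -4 & 3 & 4 \\ -7 & 7 & 8 \\ -6 & 6 & 7 \end{bmatrix},\quad M_3 = \begin{bmatrix} 1 & 3 & 4 \\ 0 & 7 & 8 \\ 0 & 6 & 7 \end{bmatrix}. \] Then $G_E$ acts on $P_E$ by left multiplication: for every $M \in G_E$ and $(a,b,c) \in P_E$, the vector $M \begin{bmatrix} a \\ b \\ c \end{bmatrix}$ is again in $P_E$. -}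

module Defs where

open import Data.Integer using (ℤ; +_; -[1+_]; _+_; _-_; _*_; -_; _≤_; 0ℤ; 1ℤ)
open import Data.Integer.GCD using (gcd)
open import Data.Fin using (Fin; zero; suc)
open import Data.Product using (_×_)
open import Relation.Nullary using (¬_)
open import Relation.Binary.PropositionalEquality using (_≡_)

Mat3 : Set
Mat3 = Fin 3 → Fin 3 → ℤ

Vec3 : Set
Vec3 = Fin 3 → ℤ

i0 i1 i2 : Fin 3
i0 = zero
i1 = suc zero
i2 = suc (suc zero)

mat : ℤ → ℤ → ℤ → ℤ → ℤ → ℤ → ℤ → ℤ → ℤ → Mat3
mat a b c d e f g h k zero zero = a
mat a b c d e f g h k zero (suc zero) = b
mat a b c d e f g h k zero (suc (suc zero)) = c
mat a b c d e f g h k (suc zero) zero = d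
mat a b c d e f g h k (suc zero) (suc zero) = e
mat a b c d e f g h k (suc zero) (suc (suc zero)) = f
mat a b c d e f g h k (suc (suc zero)) zero = g
mat a b c d e f g h k (suc (suc zero)) (suc zero) = h
mat a b c d e f g h k (suc (suc zero)) (suc (suc zero)) = k

_⊗_ : Mat3 → Mat3 → Mat3
(A ⊗ B) i j = A i i0 * B i0 j + A i i1 * B i1 j + A i i2 * B i2 j

_·_ : Mat3 → Vec3 → Vec3
(A · v) i = A i i0 * v i0 + A i i1 * v i1 + A i i2 * v i2

I3 : Mat3
I3 = mat 1ℤ 0ℤ 0ℤ 0ℤ 1ℤ 0ℤ 0ℤ 0ℤ 1ℤ

U M₁ M₂ M₃ : Mat3
U  = mat (- + 1) (+ 1) (+ 0)  (+ 0) (+ 1) (+ 0)  (+ 0) (+ 0) (+ 1)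
M₁ = mat (+ 3) (- + 4) (+ 4)  (+ 7) (- + 7) (+ 8)  (+ 6) (- + 6) (+ 7)
M₂ = mat (- + 4) (+ 3) (+ 4)  (- + 7) (+ 7) (+ 8)  (- + 6) (+ 6) (+ 7)
M₃ = mat (+ 1) (+ 3) (+ 4)  (+ 0) (+ 7) (+ 8)  (+ 0) (+ 6) (+ 7)

data InGE : Mat3 → Set where
  ge-id  : InGE I3
  ge-U   : InGE U
  ge-M₁  : InGE M₁
  ge-M₂  : InGE M₂
  ge-M₃  : InGE M₃
  ge-mul : ∀ {A B} → InGE A → InGE B → InGE (A ⊗ B)

record InPE (v : Vec3) : Set where
  field
    a-nonneg : 0ℤ ≤ v i0
    b-nonneg : 0ℤ ≤ v i1
    c-nonneg : 0ℤ ≤ v i2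
    nonzero  : ¬ (v i0 ≡ 0ℤ × v i1 ≡ 0ℤ × v i2 ≡ 0ℤ)
    eisen    : v i0 * v i0 - v i0 * v i1 + v i1 * v i1 ≡ v i2 * v i2
    a≤b      : v i0 ≤ v i1
    coprime   : gcd (gcd (v i0) (v i1)) (v i2) ≡ 1ℤ

{-# OPTIONS --safe #-}

-- Each generator M has an integral left inverse, preserves the form a² − ab + b² − c², and maps
-- the cone 0 ≤ a ≤ b, 0 ≤ c of its zeros into itself. The inverse makes the content gcd(a,b,c)
-- of M v divide that of v, so primitivity is kept, and closure under products is immediate.
-- On the cone put d = b − a, so that c² = a² + ad + d² with a, d, c ≥ 0. A linear form
-- pa + qd + rc is then nonnegative if p, q, r ≥ 0, or if r ≥ 0 and p², q², 2pq ≤ r², because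
-- r²c² − (pa + qd)² = (r² − p²)a² + (r² − 2pq)ad + (r² − q²)d² ≥ 0 bounds |pa + qd| by rc.

module Submission where

open import Defs
open import Data.Fin using (zero; suc)
open import Data.Fin.Properties using (all?)
open import Data.Integer using (ℤ; +_; +0; _+_; _-_; _*_; -_; _≤_; _<_; 0ℤ; 1ℤ; +<+)
open import Data.Integer.Base using (nonNegative)
open import Data.Integer.Divisibility.Signed using (_∣_; ∣ᵤ⇒∣; ∣⇒∣ᵤ; ∣m∣n⇒∣m+n; ∣n⇒∣m*n)
open import Data.Integer.GCD using (gcd; gcd[i,j]∣i; gcd[i,j]∣j; gcd-greatest)
open import Data.Integer.Properties
  using (_≟_; _≤?_; ≤-trans; ≤-<-trans; <⇒≤; <⇒≱; ≰⇒>; +-mono-≤; +-inverseʳ; i≤i+j; i≤j⇒0≤j-i; 0≤i-j⇒j≤i;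
         i-j≡0⇒i≡j; *-monoʳ-≤-nonNeg; *-monoˡ-≤-nonNeg; *-monoʳ-<-pos)
open import Data.Integer.Tactic.RingSolver using (solve-∀)
open import Data.Nat using (suc)
import Data.Nat.Divisibility as ℕ
open import Data.Product using (_,_)
open import Function using (_∘_)
open import Relation.Binary using (Decidable)
open import Relation.Binary.PropositionalEquality
open import Relation.Nullary using (yes; no; contradiction)
open import Relation.Nullary.Decidable using (True; toWitness; from-yes)

infix 7 _∙_
infixl 6 _-ᵥ_
infix 4 _≐_ _≐?_

_∙_ : Vec3 → Vec3 → ℤ
u ∙ v = u i0 * v i0 + u i1 * v i1 + u i2 * v i2

_-ᵥ_ : Vec3 → Vec3 → Vec3
(u -ᵥ w) i = u i - w i

_≐_ : Mat3 → Mat3 → Set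
A ≐ B = ∀ i j → A i j ≡ B i j

_≐?_ : Decidable _≐_
A ≐? B = all? λ i → all? λ j → A i j ≟ B i j

·-⊗ : ∀ A B v → (A ⊗ B) · v ≗ A · (B · v)
·-⊗ A B v i = row (A i i0) (A i i1) (A i i2) (B i0 i0) (B i0 i1) (B i0 i2) (B i1 i0) (B i1 i1) (B i1 i2)
                  (B i2 i0) (B i2 i1) (B i2 i2) (v i0) (v i1) (v i2)
  where
  row : ∀ a₀ a₁ a₂ b₀₀ b₀₁ b₀₂ b₁₀ b₁₁ b₁₂ b₂₀ b₂₁ b₂₂ x₀ x₁ x₂ →
        (a₀ * b₀₀ + a₁ * b₁₀ + a₂ * b₂₀) * x₀ + (a₀ * b₀₁ + a₁ * b₁₁ + a₂ * b₂₁) * x₁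
          + (a₀ * b₀₂ + a₁ * b₁₂ + a₂ * b₂₂) * x₂
        ≡ a₀ * (b₀₀ * x₀ + b₀₁ * x₁ + b₀₂ * x₂) + a₁ * (b₁₀ * x₀ + b₁₁ * x₁ + b₁₂ * x₂)
          + a₂ * (b₂₀ * x₀ + b₂₁ * x₁ + b₂₂ * x₂)
  row = solve-∀

·-identityˡ : ∀ v → I3 · v ≗ v
·-identityˡ v zero             = row₀ (v i0) (v i1) (v i2)
  where
  row₀ : ∀ a b c → 1ℤ * a + 0ℤ * b + 0ℤ * c ≡ a
  row₀ = solve-∀
·-identityˡ v (suc zero)       = row₁ (v i0) (v i1) (v i2)
  where
  row₁ : ∀ a b c → 0ℤ * a + 1ℤ * b + 0ℤ * c ≡ b
  row₁ = solve-∀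
·-identityˡ v (suc (suc zero)) = row₂ (v i0) (v i1) (v i2)
  where
  row₂ : ∀ a b c → 0ℤ * a + 0ℤ * b + 1ℤ * c ≡ c
  row₂ = solve-∀

·-congˡ : ∀ {A B} → A ≐ B → ∀ v → A · v ≗ B · v
·-congˡ A≐B v i =
  cong₂ _+_ (cong₂ _+_ (cong (_* v i0) (A≐B i i0)) (cong (_* v i1) (A≐B i i1))) (cong (_* v i2) (A≐B i i2))

∙-distribʳ-ᵥ : ∀ u w v → (u -ᵥ w) ∙ v ≡ u ∙ v - w ∙ v
∙-distribʳ-ᵥ u w v = distrib (u i0) (u i1) (u i2) (w i0) (w i1) (w i2) (v i0) (v i1) (v i2)
  where
  distrib : ∀ u₀ u₁ u₂ w₀ w₁ w₂ x₀ x₁ x₂ →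
            (u₀ - w₀) * x₀ + (u₁ - w₁) * x₁ + (u₂ - w₂) * x₂
            ≡ (u₀ * x₀ + u₁ * x₁ + u₂ * x₂) - (w₀ * x₀ + w₁ * x₁ + w₂ * x₂)
  distrib = solve-∀

content : Vec3 → ℤ
content v = gcd (gcd (v i0) (v i1)) (v i2)

content-cong : ∀ {v w} → v ≗ w → content v ≡ content w
content-cong v≗w = cong₂ gcd (cong₂ gcd (v≗w i0) (v≗w i1)) (v≗w i2)

content-∣ : ∀ v i → content v ∣ v i
content-∣ v zero             = ∣ᵤ⇒∣ (ℕ.∣-trans (gcd[i,j]∣i (gcd (v i0) (v i1)) (v i2)) (gcd[i,j]∣i (v i0) (v i1)))
content-∣ v (suc zero)       = ∣ᵤ⇒∣ (ℕ.∣-trans (gcd[i,j]∣i (gcd (v i0) (v i1)) (v i2)) (gcd[i,j]∣j (v i0) (v i1)))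
content-∣ v (suc (suc zero)) = ∣ᵤ⇒∣ (gcd[i,j]∣j (gcd (v i0) (v i1)) (v i2))

∣-content : ∀ {g} v → (∀ i → g ∣ v i) → g ∣ content v
∣-content {g} v g∣v = ∣ᵤ⇒∣ (gcd-greatest {gcd (v i0) (v i1)} {v i2} {g}
  (gcd-greatest {v i0} {v i1} {g} (∣⇒∣ᵤ (g∣v i0)) (∣⇒∣ᵤ (g∣v i1))) (∣⇒∣ᵤ (g∣v i2)))

∣-· : ∀ {g v} M → (∀ i → g ∣ v i) → ∀ i → g ∣ (M · v) i
∣-· M g∣v i = ∣m∣n⇒∣m+n (∣m∣n⇒∣m+n (∣n⇒∣m*n (M i i0) (g∣v i0)) (∣n⇒∣m*n (M i i1) (g∣v i1)))
                        (∣n⇒∣m*n (M i i2) (g∣v i2))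

content-∣-content-· : ∀ M v → content v ∣ content (M · v)
content-∣-content-· M v = ∣-content (M · v) (∣-· M (content-∣ v))

content-·-∣-content : ∀ N M → N ⊗ M ≐ I3 → ∀ v → content (M · v) ∣ content v
content-·-∣-content N M N⊗M≐I3 v =
  subst (content (M · v) ∣_) (content-cong N·M·v≗v) (content-∣-content-· N (M · v))
  where
  N·M·v≗v : N · (M · v) ≗ v
  N·M·v≗v i = begin
    (N · (M · v)) i  ≡⟨ ·-⊗ N M v i ⟨
    ((N ⊗ M) · v) i  ≡⟨ ·-congˡ N⊗M≐I3 v i ⟩
    (I3 · v) i       ≡⟨ ·-identityˡ v i ⟩
    v i              ∎
    where open ≡-Reasoning

primitive-· : ∀ N M → N ⊗ M ≐ I3 → ∀ {v} → content v ≡ 1ℤ → content (M · v) ≡ 1ℤ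
primitive-· N M N⊗M≐I3 {v} v-primitive = cong +_ (ℕ.∣1⇒≡1 (∣⇒∣ᵤ {content (M · v)} {1ℤ} Mv∣1))
  where
  Mv∣1 : content (M · v) ∣ 1ℤ
  Mv∣1 = subst (content (M · v) ∣_) v-primitive (content-·-∣-content N M N⊗M≐I3 v)

0≤-* : ∀ {x y} → 0ℤ ≤ x → 0ℤ ≤ y → 0ℤ ≤ x * y
0≤-* {y = y} 0≤x 0≤y = *-monoʳ-≤-nonNeg y {{nonNegative 0≤y}} 0≤x

≤-by-squares : ∀ {x k} → 0ℤ ≤ k → x * x ≤ k * k → x ≤ k
≤-by-squares {x} {k} 0≤k x²≤k² with x ≤? k
... | yes x≤k = x≤k
... | no  x≰k = contradiction x²≤k² (<⇒≱ (squares-< 0≤k (≰⇒> x≰k)))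
  where
  squares-< : ∀ {k x} → 0ℤ ≤ k → k < x → k * k < x * x
  squares-< {+ m} {+ suc n} _ k<x =
    ≤-<-trans (*-monoˡ-≤-nonNeg (+ m) (<⇒≤ k<x)) (*-monoʳ-<-pos (+ suc n) k<x)
  squares-< {+ _} {+0} _ (+<+ ())

0≤+-by-squares : ∀ {x k} → 0ℤ ≤ k → x * x ≤ k * k → 0ℤ ≤ x + k
0≤+-by-squares {x} {k} 0≤k x²≤k² =
  subst (0ℤ ≤_) (rearrange x k) (i≤j⇒0≤j-i (≤-by-squares 0≤k (subst (_≤ k * k) (square-neg x) x²≤k²)))
  where
  square-neg : ∀ x → x * x ≡ (- x) * (- x)
  square-neg = solve-∀
  rearrange : ∀ x k → k - (- x) ≡ x + k
  rearrange = solve-∀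

0≤-dominated : ∀ {a d c} p q r → 0ℤ ≤ a → 0ℤ ≤ d → 0ℤ ≤ c → c * c ≡ a * a + a * d + d * d →
               0ℤ ≤ r → p * p ≤ r * r → q * q ≤ r * r → + 2 * p * q ≤ r * r →
               0ℤ ≤ p * a + q * d + r * c
0≤-dominated {a} {d} {c} p q r 0≤a 0≤d 0≤c c²≡ 0≤r p²≤r² q²≤r² 2pq≤r² =
  0≤+-by-squares {x} (0≤-* 0≤r 0≤c) x²≤k²
  where
  x : ℤ
  x = p * a + q * d
  slack : ℤ
  slack = (r * r - p * p) * (a * a) + (r * r - + 2 * p * q) * (a * d) + (r * r - q * q) * (d * d)
  0≤slack : 0ℤ ≤ slack
  0≤slack = +-mono-≤ (+-mono-≤ (0≤-* (i≤j⇒0≤j-i p²≤r²) (0≤-* 0≤a 0≤a))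
                               (0≤-* (i≤j⇒0≤j-i 2pq≤r²) (0≤-* 0≤a 0≤d)))
                     (0≤-* (i≤j⇒0≤j-i q²≤r²) (0≤-* 0≤d 0≤d))
  square-product : ∀ r c → (r * c) * (r * c) ≡ r * r * (c * c)
  square-product = solve-∀
  expand : ∀ p q r a d → r * r * (a * a + a * d + d * d)
                        ≡ (p * a + q * d) * (p * a + q * d)
                          + ((r * r - p * p) * (a * a) + (r * r - + 2 * p * q) * (a * d) + (r * r - q * q) * (d * d))
  expand = solve-∀
  rc²≡ : (r * c) * (r * c) ≡ x * x + slack
  rc²≡ = begin
    (r * c) * (r * c)                     ≡⟨ square-product r c ⟩
    r * r * (c * c)                       ≡⟨ cong (r * r *_) c²≡ ⟩
    r * r * (a * a + a * d + d * d)       ≡⟨ expand p q r a d ⟩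
    x * x + slack                         ∎
    where open ≡-Reasoning
  x²≤k² : x * x ≤ (r * c) * (r * c)
  x²≤k² = subst (x * x ≤_) (sym rc²≡) (i≤i+j (x * x) slack {{nonNegative 0≤slack}})

record InCone (v : Vec3) : Set where
  field
    a-nonneg : 0ℤ ≤ v i0
    a≤b      : v i0 ≤ v i1
    c-nonneg : 0ℤ ≤ v i2
    eisen    : v i0 * v i0 - v i0 * v i1 + v i1 * v i1 ≡ v i2 * v i2

  d-nonneg : 0ℤ ≤ v i1 - v i0
  d-nonneg = i≤j⇒0≤j-i a≤b

  eisen-ad : v i2 * v i2 ≡ v i0 * v i0 + v i0 * (v i1 - v i0) + (v i1 - v i0) * (v i1 - v i0)
  eisen-ad = trans (sym eisen) (norm-ad (v i0) (v i1))
    where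
    norm-ad : ∀ a b → a * a - a * b + b * b ≡ a * a + a * (b - a) + (b - a) * (b - a)
    norm-ad = solve-∀

∙-ad : ∀ u v → u ∙ v ≡ (u i0 + u i1) * v i0 + u i1 * (v i1 - v i0) + u i2 * v i2
∙-ad u v = change (u i0) (u i1) (u i2) (v i0) (v i1) (v i2)
  where
  change : ∀ u₀ u₁ u₂ a b c → u₀ * a + u₁ * b + u₂ * c ≡ (u₀ + u₁) * a + u₁ * (b - a) + u₂ * c
  change = solve-∀

NonnegOnCone : Vec3 → Set
NonnegOnCone u = ∀ {v} → InCone v → 0ℤ ≤ u ∙ v

nonnegOnCone-coefficients : ∀ u → {True (0ℤ ≤? u i0 + u i1)} → {True (0ℤ ≤? u i1)} → {True (0ℤ ≤? u i2)} →
                            NonnegOnCone u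
nonnegOnCone-coefficients u {0≤p} {0≤q} {0≤r} {v} v∈C =
  subst (0ℤ ≤_) (sym (∙-ad u v))
    (+-mono-≤ (+-mono-≤ (0≤-* (toWitness 0≤p) a-nonneg) (0≤-* (toWitness 0≤q) d-nonneg))
              (0≤-* (toWitness 0≤r) c-nonneg))
  where open InCone v∈C

nonnegOnCone-dominated : ∀ u → let p = u i0 + u i1 ; q = u i1 ; r = u i2 in
                         {True (0ℤ ≤? r)} → {True (p * p ≤? r * r)} → {True (q * q ≤? r * r)} →
                         {True (+ 2 * p * q ≤? r * r)} → NonnegOnCone u
nonnegOnCone-dominated u {0≤r} {p²≤r²} {q²≤r²} {2pq≤r²} {v} v∈C =
  subst (0ℤ ≤_) (sym (∙-ad u v))
    (0≤-dominated (u i0 + u i1) (u i1) (u i2) a-nonneg d-nonneg c-nonneg eisen-ad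
                  (toWitness 0≤r) (toWitness p²≤r²) (toWitness q²≤r²) (toWitness 2pq≤r²))
  where open InCone v∈C

form : Vec3 → ℤ
form v = v i0 * v i0 - v i0 * v i1 + v i1 * v i1 - v i2 * v i2

PreservesForm : Mat3 → Set
PreservesForm M = ∀ v → form (M · v) ≡ form v

InCone-· : ∀ {M} → PreservesForm M → NonnegOnCone (M i0) → NonnegOnCone (M i2) → NonnegOnCone (M i1 -ᵥ M i0) →
           ∀ {v} → InCone v → InCone (M · v)
InCone-· {M} M-form row₀ row₂ row₁₀ {v} v∈C = record
  { a-nonneg = row₀ v∈C
  ; a≤b      = 0≤i-j⇒j≤i (subst (0ℤ ≤_) (∙-distribʳ-ᵥ (M i1) (M i0) v) (row₁₀ v∈C))
  ; c-nonneg = row₂ v∈C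
  ; eisen    = i-j≡0⇒i≡j _ _ (trans (M-form v) form≡0)
  }
  where
  open InCone v∈C
  form≡0 : form v ≡ 0ℤ
  form≡0 = trans (cong (_- v i2 * v i2) eisen) (+-inverseʳ (v i2 * v i2))

InPE⇒InCone : ∀ {v} → InPE v → InCone v
InPE⇒InCone p = record { a-nonneg = a-nonneg ; a≤b = a≤b ; c-nonneg = c-nonneg ; eisen = eisen }
  where open InPE p

InPE-intro : ∀ {v} → InCone v → content v ≡ 1ℤ → InPE v
InPE-intro {v} v∈C v-primitive = record
  { a-nonneg = a-nonneg
  ; b-nonneg = ≤-trans a-nonneg a≤b
  ; c-nonneg = c-nonneg
  ; nonzero  = λ (a≡0 , b≡0 , c≡0) → 0≢1 (trans (sym (cong₂ gcd (cong₂ gcd a≡0 b≡0) c≡0)) v-primitive)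
  ; eisen    = eisen
  ; a≤b      = a≤b
  ; coprime  = v-primitive
  }
  where
  open InCone v∈C
  0≢1 : 0ℤ ≢ 1ℤ
  0≢1 ()

InPE-resp-≗ : ∀ {v w} → v ≗ w → InPE v → InPE w
InPE-resp-≗ {v} {w} v≗w p = InPE-intro w∈C (trans (sym (content-cong v≗w)) coprime)
  where
  open InPE p
  w∈C : InCone w
  w∈C = record
    { a-nonneg = subst (0ℤ ≤_) (v≗w i0) a-nonneg
    ; a≤b      = subst₂ _≤_ (v≗w i0) (v≗w i1) a≤b
    ; c-nonneg = subst (0ℤ ≤_) (v≗w i2) c-nonneg
    ; eisen    = subst₂ _≡_ (cong₂ (λ a b → a * a - a * b + b * b) (v≗w i0) (v≗w i1))
                            (cong₂ _*_ (v≗w i2) (v≗w i2)) eisen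
    }

Preserves : Mat3 → Set
Preserves M = ∀ v → InPE v → InPE (M · v)

I3-preserves : Preserves I3
I3-preserves v = InPE-resp-≗ (sym ∘ ·-identityˡ v)

Preserves-⊗ : ∀ {A B} → Preserves A → Preserves B → Preserves (A ⊗ B)
Preserves-⊗ {A} {B} A-pres B-pres v p = InPE-resp-≗ (sym ∘ ·-⊗ A B v) (A-pres (B · v) (B-pres v p))

preserves : ∀ N M → N ⊗ M ≐ I3 → PreservesForm M →
            NonnegOnCone (M i0) → NonnegOnCone (M i2) → NonnegOnCone (M i1 -ᵥ M i0) → Preserves M
preserves N M N⊗M≐I3 M-form row₀ row₂ row₁₀ v p =
  InPE-intro (InCone-· {M} M-form row₀ row₂ row₁₀ (InPE⇒InCone p)) (primitive-· N M N⊗M≐I3 {v} (InPE.coprime p))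

M₁⁻¹ M₂⁻¹ M₃⁻¹ : Mat3
M₁⁻¹ = mat (- + 1) (+ 4) (- + 4)  (- + 1) (- + 3) (+ 4)  (+ 0) (- + 6) (+ 7)
M₂⁻¹ = mat (- + 1) (- + 3) (+ 4)  (- + 1) (+ 4) (- + 4)  (+ 0) (- + 6) (+ 7)
M₃⁻¹ = mat (+ 1) (+ 3) (- + 4)  (+ 0) (+ 7) (- + 8)  (+ 0) (- + 6) (+ 7)

U-preserves : Preserves U
U-preserves = preserves U U (from-yes (U ⊗ U ≐? I3)) (λ v → invariant (v i0) (v i1) (v i2))
  (nonnegOnCone-coefficients (U i0)) (nonnegOnCone-coefficients (U i2))
  (nonnegOnCone-coefficients (U i1 -ᵥ U i0))
  where
  invariant : ∀ a b c → let x = - + 1 * a + + 1 * b + + 0 * c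
                            y = + 0 * a + + 1 * b + + 0 * c
                            z = + 0 * a + + 0 * b + + 1 * c
                        in x * x - x * y + y * y - z * z ≡ a * a - a * b + b * b - c * c
  invariant = solve-∀

M₁-preserves : Preserves M₁
M₁-preserves = preserves M₁⁻¹ M₁ (from-yes (M₁⁻¹ ⊗ M₁ ≐? I3)) (λ v → invariant (v i0) (v i1) (v i2))
  (nonnegOnCone-dominated (M₁ i0)) (nonnegOnCone-dominated (M₁ i2))
  (nonnegOnCone-dominated (M₁ i1 -ᵥ M₁ i0))
  where
  invariant : ∀ a b c → let x = + 3 * a + - + 4 * b + + 4 * c
                            y = + 7 * a + - + 7 * b + + 8 * c
                            z = + 6 * a + - + 6 * b + + 7 * c
                        in x * x - x * y + y * y - z * z ≡ a * a - a * b + b * b - c * c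
  invariant = solve-∀

M₂-preserves : Preserves M₂
M₂-preserves = preserves M₂⁻¹ M₂ (from-yes (M₂⁻¹ ⊗ M₂ ≐? I3)) (λ v → invariant (v i0) (v i1) (v i2))
  (nonnegOnCone-dominated (M₂ i0)) (nonnegOnCone-coefficients (M₂ i2))
  (nonnegOnCone-coefficients (M₂ i1 -ᵥ M₂ i0))
  where
  invariant : ∀ a b c → let x = - + 4 * a + + 3 * b + + 4 * c
                            y = - + 7 * a + + 7 * b + + 8 * c
                            z = - + 6 * a + + 6 * b + + 7 * c
                        in x * x - x * y + y * y - z * z ≡ a * a - a * b + b * b - c * c
  invariant = solve-∀

M₃-preserves : Preserves M₃
M₃-preserves = preserves M₃⁻¹ M₃ (from-yes (M₃⁻¹ ⊗ M₃ ≐? I3)) (λ v → invariant (v i0) (v i1) (v i2))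
  (nonnegOnCone-coefficients (M₃ i0)) (nonnegOnCone-coefficients (M₃ i2))
  (nonnegOnCone-coefficients (M₃ i1 -ᵥ M₃ i0))
  where
  invariant : ∀ a b c → let x = + 1 * a + + 3 * b + + 4 * c
                            y = + 0 * a + + 7 * b + + 8 * c
                            z = + 0 * a + + 6 * b + + 7 * c
                        in x * x - x * y + y * y - z * z ≡ a * a - a * b + b * b - c * c
  invariant = solve-∀

lemma6p1 : ∀ (M : Mat3) (v : Vec3) → InGE M → InPE v → InPE (M · v)
lemma6p1 _ v ge-id                    = I3-preserves v
lemma6p1 _ v ge-U                     = U-preserves v
lemma6p1 _ v ge-M₁                    = M₁-preserves v
lemma6p1 _ v ge-M₂                    = M₂-preserves v
lemma6p1 _ v ge-M₃                    = M₃-preserves v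
lemma6p1 _ v (ge-mul {A} {B} A∈G B∈G) =
  Preserves-⊗ {A} {B} (λ w → lemma6p1 A w A∈G) (λ w → lemma6p1 B w B∈G) v
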